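{- Let $k$, $n$ and $K$ be positive integers with $K\leq k$, and let $N=\left\lceil n\big/\left\lfloor\frac{k+1}{K+1}\right\rfloor\right\rceil$. If there is a $K$-radius sequence over an $N$-element alphabet of length $s$, then there is a $k$-radius sequence over an $n$-element alphabet of length $s\left\lfloor\frac{k+1}{K+1}\right\rfloor$.
   Context: For a positive integer $r$ and a finite alphabet $A$, a sequence $x_1,\ldots,x_m$ of elements of $A$ is an $r$-radius sequence over $A$ if for every $a,b\in A$ there are indices $i,j$ with $x_i=a$, $x_j=b$ and $|i-j|\leq r$. -}

module Defs where

open import Data.Nat using (ℕ; zero; suc; _+_; _≤_; ∣_-_∣)
open import Data.Nat.DivMod using (_/_)
open import Data.Fin using (Fin; toℕ)
open import Data.Product using (Σ; _×_)
open import Relation.Binary.PropositionalEquality using (_≡_)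

-- Ceiling division ⌈ n / q ⌉ for q ≥ 1 (value at q = 0 is an
-- irrelevant convention, only used with q ≥ 1).
⌈_/_⌉ : ℕ → ℕ → ℕ
⌈ n / zero ⌉ = 0
⌈ n / suc q ⌉ = (n + q) / suc q

IsRadiusSeq : (r : ℕ) {A : Set} {m : ℕ} → (Fin m → A) → Set
IsRadiusSeq r {A} {m} x =
  (a b : A) → Σ (Fin m) λ i → Σ (Fin m) λ j →
    (x i ≡ a) × (x j ≡ b) × (∣ toℕ i - toℕ j ∣ ≤ r)

module Submission where

-- Put q = ⌊(k+1)/(K+1)⌋ ≥ 1.  Letters of the big alphabet Fin n are grouped
-- into blocks of q consecutive letters: u = q·⌊u/q⌋ + (u mod q), so the block
-- index ⌊u/q⌋ ranges over N = ⌈n/q⌉ values.  Given a K-radius sequence y over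
-- the N block indices, replace every term y_i by the q letters of its block,
-- q·y_i + 0, …, q·y_i + (q-1) (values ≥ n are replaced by an arbitrary letter).
-- The result x has length s·q, and x at position q·i + t is q·y_i + t.
-- For letters u, v pick i, j with y_i = ⌊u/q⌋, y_j = ⌊v/q⌋ and |i - j| ≤ K;
-- then u sits at position q·i + (u mod q), v at q·j + (v mod q), and these
-- positions differ by less than q·K + q = q·(K+1) ≤ k+1.

open import Defs
open import Data.Nat using (ℕ; suc; _+_; _*_; _≤_; _<_; _<?_; s≤s; s≤s⁻¹; ∣_-_∣; NonZero; >-nonZero)
open import Data.Nat.Properties
open import Data.Nat.DivMod using (_/_; _%_; m%n<n; m≡m%n+[m/n]*n; m<n*o⇒m/o<n; m/n*n≤m; m≥n⇒m/n>0)
open import Data.Fin using (Fin; zero; toℕ; fromℕ<; combine; remQuot)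
open import Data.Fin.Properties using (toℕ-fromℕ<; toℕ-injective; toℕ-combine; remQuot-combine; toℕ<n)
open import Data.Product using (Σ; _,_; _×_)
open import Relation.Nullary using (yes; no; contradiction)
open import Relation.Binary.PropositionalEquality using (_≡_; trans; cong; cong₂; module ≡-Reasoning)

∣-∣-subadditive : ∀ a b c d → ∣ a + c - b + d ∣ ≤ ∣ a - b ∣ + ∣ c - d ∣
∣-∣-subadditive a b c d = begin
  ∣ a + c - b + d ∣                      ≤⟨ ∣-∣-triangle (a + c) (b + c) (b + d) ⟩
  ∣ a + c - b + c ∣ + ∣ b + c - b + d ∣  ≡⟨ cong₂ _+_ shiftRight (∣m+n-m+o∣≡∣n-o∣ b c d) ⟩
  ∣ a - b ∣ + ∣ c - d ∣                  ∎
  where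
  open ≤-Reasoning
  shiftRight : ∣ a + c - b + c ∣ ≡ ∣ a - b ∣
  shiftRight = trans (cong₂ ∣_-_∣ (+-comm a c) (+-comm b c)) (∣m+n-m+o∣≡∣n-o∣ c a b)

offsets-close : ∀ {q t t'} → t < q → t' < q → ∣ t - t' ∣ < q
offsets-close {t = t} {t'} t<q t'<q = ≤-<-trans (∣m-n∣≤m⊔n t t') (⊔-lub t<q t'<q)

block-distance : ∀ q {i j t t' K} → t < q → t' < q → ∣ i - j ∣ ≤ K →
                 ∣ q * i + t - q * j + t' ∣ < q * suc K
block-distance q {i} {j} {t} {t'} {K} t<q t'<q i~j = begin-strict
  ∣ q * i + t - q * j + t' ∣       ≤⟨ ∣-∣-subadditive (q * i) (q * j) t t' ⟩
  ∣ q * i - q * j ∣ + ∣ t - t' ∣   ≡⟨ cong (_+ ∣ t - t' ∣) (*-distribˡ-∣-∣ q i j) ⟨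
  q * ∣ i - j ∣ + ∣ t - t' ∣       <⟨ +-mono-≤-< (*-monoʳ-≤ q i~j) (offsets-close t<q t'<q) ⟩
  q * K + q                        ≡⟨ +-comm (q * K) q ⟩
  q + q * K                        ≡⟨ *-suc q K ⟨
  q * suc K                        ∎
  where open ≤-Reasoning

≤⌈/⌉* : ∀ n q .{{_ : NonZero q}} → n ≤ ⌈ n / q ⌉ * q
≤⌈/⌉* n (suc q') = +-cancelʳ-≤ q' n (⌈ n / q ⌉ * q) (begin
  n + q'                           ≡⟨ m≡m%n+[m/n]*n (n + q') q ⟩
  (n + q') % q + ⌈ n / q ⌉ * q     ≤⟨ +-monoˡ-≤ (⌈ n / q ⌉ * q) (s≤s⁻¹ (m%n<n (n + q') q)) ⟩
  q' + ⌈ n / q ⌉ * q               ≡⟨ +-comm q' (⌈ n / q ⌉ * q) ⟩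
  ⌈ n / q ⌉ * q + q'               ∎)
  where
  open ≤-Reasoning
  q = suc q'

module BlowUp {n N q : ℕ} .{{_ : NonZero q}} (covered : n ≤ N * q) where

  block : Fin n → Fin N
  block u = fromℕ< (m<n*o⇒m/o<n (<-≤-trans (toℕ<n u) covered))

  offset : Fin n → Fin q
  offset u = fromℕ< (m%n<n (toℕ u) q)

  block-offset : ∀ u → q * toℕ (block u) + toℕ (offset u) ≡ toℕ u
  block-offset u = begin
    q * toℕ (block u) + toℕ (offset u)  ≡⟨ cong₂ _+_ (cong (q *_) (toℕ-fromℕ< _)) (toℕ-fromℕ< _) ⟩
    q * (toℕ u / q) + toℕ u % q         ≡⟨ cong (_+ toℕ u % q) (*-comm q (toℕ u / q)) ⟩
    toℕ u / q * q + toℕ u % q           ≡⟨ +-comm (toℕ u / q * q) (toℕ u % q) ⟩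
    toℕ u % q + toℕ u / q * q           ≡⟨ m≡m%n+[m/n]*n (toℕ u) q ⟨
    toℕ u                               ∎
    where open ≡-Reasoning

  -- The letter with value v, or an arbitrary letter if v ≥ n (which only
  -- happens in the last, incomplete block).
  letter : Fin n → ℕ → Fin n
  letter default v with v <? n
  ... | yes v<n = fromℕ< v<n
  ... | no  _   = default

  letter-toℕ : ∀ default u → letter default (toℕ u) ≡ u
  letter-toℕ default u with toℕ u <? n
  ... | yes u<n = toℕ-injective (toℕ-fromℕ< u<n)
  ... | no  u≮n = contradiction (toℕ<n u) u≮n

  blockLetter : ∀ {s} → Fin n → (Fin s → Fin N) → Fin s × Fin q → Fin n
  blockLetter default y (i , t) = letter default (q * toℕ (y i) + toℕ t)

  blowUp : ∀ {s} → Fin n → (Fin s → Fin N) → Fin (s * q) → Fin n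
  blowUp default y p = blockLetter default y (remQuot q p)

  blowUp-hits : ∀ {s} default (y : Fin s → Fin N) i u → y i ≡ block u →
                blowUp default y (combine i (offset u)) ≡ u
  blowUp-hits default y i u yi≡u = begin
    blowUp default y (combine i (offset u))              ≡⟨ cong (blockLetter default y) (remQuot-combine i (offset u)) ⟩
    letter default (q * toℕ (y i) + toℕ (offset u))      ≡⟨ cong (λ b → letter default (q * toℕ b + toℕ (offset u))) yi≡u ⟩
    letter default (q * toℕ (block u) + toℕ (offset u))  ≡⟨ cong (letter default) (block-offset u) ⟩
    letter default (toℕ u)                               ≡⟨ letter-toℕ default u ⟩
    u                                                    ∎
    where open ≡-Reasoning

  combine-close : ∀ {s K k} (i j : Fin s) (t t' : Fin q) → q * suc K ≤ suc k →
                  ∣ toℕ i - toℕ j ∣ ≤ K → ∣ toℕ (combine i t) - toℕ (combine j t') ∣ ≤ k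
  combine-close {K = K} {k} i j t t' spread i~j = s≤s⁻¹ (begin-strict
    ∣ toℕ (combine i t) - toℕ (combine j t') ∣        ≡⟨ cong₂ ∣_-_∣ (toℕ-combine i t) (toℕ-combine j t') ⟩
    ∣ q * toℕ i + toℕ t - q * toℕ j + toℕ t' ∣        <⟨ block-distance q (toℕ<n t) (toℕ<n t') i~j ⟩
    q * suc K                                        ≤⟨ spread ⟩
    suc k                                            ∎)
    where open ≤-Reasoning

  blowUp-radius : ∀ {s K k} default (y : Fin s → Fin N) → q * suc K ≤ suc k →
                  IsRadiusSeq K y → IsRadiusSeq k (blowUp default y)
  blowUp-radius default y spread y-radius u v
    with i , j , yi≡u , yj≡v , i~j ← y-radius (block u) (block v) =
    combine i (offset u) , combine j (offset v) ,
    blowUp-hits default y i u yi≡u , blowUp-hits default y j v yj≡v ,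
    combine-close i j (offset u) (offset v) spread i~j

-- With q = ⌊(k+1)/(K+1)⌋ (positive since K ≤ k) the spread condition
-- q·(K+1) ≤ k+1 holds by definition of q, and ⌈n/q⌉ blocks cover Fin n.
lemma14 : (k n K s : ℕ) → 1 ≤ k → 1 ≤ n → 1 ≤ K → K ≤ k →
    Σ (Fin s → Fin ⌈ n / (suc k / suc K) ⌉) (IsRadiusSeq K) →
    Σ (Fin (s * (suc k / suc K)) → Fin n) (IsRadiusSeq k)
lemma14 k (suc n') K s _ _ _ K≤k (y , y-radius) =
  blowUp zero y , blowUp-radius zero y (m/n*n≤m (suc k) (suc K)) y-radius
  where
  q = suc k / suc K
  instance
    q-nonZero : NonZero q
    q-nonZero = >-nonZero (m≥n⇒m/n>0 (s≤s K≤k))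
  open BlowUp {N = ⌈ suc n' / q ⌉} {q} (≤⌈/⌉* (suc n') q)
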